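{- Let $G_{sw}=(G,(w_v,s_v),(w_e,s_e))$ be a connected strength-weighted graph, let $\{E_1,\ldots,E_k\}$ be a c-partition of $E(G)$, and for $i\in\{1,\ldots,k\}$ let $G_i=G_{sw}/E_i$ be the strength-weighted quotient graph. Let $i\in\{1,\ldots,k\}$, let $e=uv\in E_i$, and put $U=\ell_i(u)$, $V=\ell_i(v)$ and $E=UV\in E(G_i)$. Then $$n_0(e\,|\,G_{sw})=n_0(E\,|\,G_i)\quad\text{and}\quad m_0(e\,|\,G_{sw})=m_0(E\,|\,G_i).$$
   Context: All graphs are simple and finite. For a connected graph $G$, $d_G(u,v)$ denotes the shortest-path distance between $u,v\in V(G)$, and for a vertex $u$ and an edge $f=xy$ we set $d_G(u,f)=\min\{d_G(u,x),d_G(u,y)\}$. A strength-weighted graph is a triple $G_{sw}=(G,(w_v,s_v),(w_e,s_e))$, where $G$ is a simple graph, $w_v,s_v:V(G)\to\mathbb{R}_0^+$ and $w_e,s_e:E(G)\to\mathbb{R}_0^+$. For an edge $e=uv$ of a connected graph $G$ let $N_u(e|G)=\{x\in V(G): d_G(u,x)<d_G(v,x)\}$, $N_0(e|G)=\{x\in V(G): d_G(u,x)=d_G(v,x)\}$, $M_u(e|G)=\{f\in E(G): d_G(u,f)<d_G(v,f)\}$, $M_0(e|G)=\{f\in E(G): d_G(u,f)=d_G(v,f)\}$, and define $N_v(e|G)$, $M_v(e|G)$ symmetrically. For a connected strength-weighted graph $G_{sw}$ and $e=uv\in E(G)$ set $n_u(e|G_{sw})=\sum_{x\in N_u(e|G)}w_v(x)$,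 $m_u(e|G_{sw})=\sum_{x\in N_u(e|G)}s_v(x)+\sum_{f\in M_u(e|G)}s_e(f)$, $n_0(e|G_{sw})=\sum_{x\in N_0(e|G)}w_v(x)$, $m_0(e|G_{sw})=\sum_{x\in N_0(e|G)}s_v(x)+\sum_{f\in M_0(e|G)}s_e(f)$, and $n_v(e|G_{sw})$, $m_v(e|G_{sw})$ analogously. Two edges $u_1v_1$, $u_2v_2$ of a connected graph are in relation $\Theta$ if $d(u_1,u_2)+d(v_1,v_2)\neq d(u_1,v_2)+d(u_2,v_1)$; $\Theta^*$ is the transitive closure of $\Theta$. A partition $\{E_1,\ldots,E_k\}$ of $E(G)$ is a c-partition if each $E_i$ is a union of one or more $\Theta^*$-classes of $G$. For $F\subseteq E(G)$, the quotient graph $G/F$ has as vertices the connected components of $G\setminus F$ (the graph $G$ with the edges of $F$ removed), two components $X,Y$ being adjacent if some vertex of $X$ is adjacent in $G$ to some vertex of $Y$. For an edge $E=XY$ of $G/F$, let $\widehat{E}=\{xy\in E(G): x\in V(X), y\in V(Y)\}$. For a c-partition $\{E_1,\ldots,E_k\}$, the map $\ell_i:V(G)\to V(G/E_i)$ sends $u$ to the component of $G\setminus E_i$ containing $u$ (for $uv\in E_i$, $\ell_i(u)$ and $\ell_i(v)$ are adjacent in $G/E_i$). The strength-weighted quotient graph $G_i=G_{sw}/E_i$ is $G/E_i$ with weights: $w_v^i(X)=\sum_{x\in V(X)}w_v(x)$, $s_v^i(X)=\sum_{f\in E(X)}s_e(f)+\sum_{x\in V(X)}s_v(x)$ for $X\in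 V(G/E_i)$, and $w_e^i(E)=\sum_{e\in\widehat{E}}w_e(e)$, $s_e^i(E)=\sum_{e\in\widehat{E}}s_e(e)$ for $E\in E(G/E_i)$. The quantities $n_0(E|G_i)$, $m_0(E|G_i)$ are computed in $G_i$ with these weights. -}

module Defs where

open import Level using (Level; _⊔_)
open import Data.Nat using (ℕ; zero; suc; _+_; _≡ᵇ_; _<ᵇ_; _⊓_)
open import Data.Bool using (Bool; true; false; _∧_; _∨_; not; if_then_else_)
open import Data.Fin using (Fin; toℕ; _≟_)
import Data.Fin as F
open import Data.Product using (Σ; _×_; _,_; ∃; proj₁; proj₂)
open import Function.Bundles using (_⇔_)
open import Relation.Nullary using (¬_)
open import Relation.Nullary.Decidable using (⌊_⌋)
open import Relation.Binary.PropositionalEquality using (_≡_; _≢_)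
open import Relation.Binary.Construct.Closure.Transitive using (TransClosure)
open import Algebra.Bundles using (CommutativeMonoid)

Adj : ℕ → Set
Adj n = Fin n → Fin n → Bool

record SimpleGraph (n : ℕ) : Set where
  field
    adj     : Adj n
    adj-sym : ∀ x y → adj x y ≡ adj y x
    adj-irr : ∀ x → adj x x ≡ false
open SimpleGraph public

data Walk {n : ℕ} (A : Adj n) : ℕ → Fin n → Fin n → Set where
  here : ∀ {x} → Walk A 0 x x
  step : ∀ {k x y z} → A x y ≡ true → Walk A k y z → Walk A (suc k) x z

Connected : ∀ {n} → SimpleGraph n → Set
Connected G = ∀ x y → ∃ λ k → Walk (adj G) k x y

anyF : ∀ {n} → (Fin n → Bool) → Bool
anyF {zero}  f = false
anyF {suc n} f = f F.zero ∨ anyF (λ x → f (F.suc x))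

reach : ∀ {n} → Adj n → ℕ → Fin n → Fin n → Bool
reach A zero    u v = ⌊ u ≟ v ⌋
reach A (suc k) u v = reach A k u v ∨ anyF (λ w → reach A k u w ∧ A w v)

distFrom : ∀ {n} → Adj n → Fin n → Fin n → ℕ → ℕ → ℕ
distFrom A u v zero     k = k
distFrom A u v (suc f)  k = if reach A k u v then k else distFrom A u v f (suc k)

-- shortest-path distance d_G(u,v) (correct for connected graphs)
dist : ∀ {n} → Adj n → Fin n → Fin n → ℕ
dist {n} A u v = distFrom A u v n 0

distE : ∀ {n} → Adj n → Fin n → Fin n → Fin n → ℕ
distE A u x y = dist A u x ⊓ dist A u y

-- edges are represented by pairs (x , y) with x < y and adjacent.
isEdge : ∀ {n} → Adj n → Fin n → Fin n → Bool
isEdge A x y = (toℕ x <ᵇ toℕ y) ∧ A x y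

IsEdge : ∀ {n} → Adj n → Fin n × Fin n → Set
IsEdge A (x , y) = isEdge A x y ≡ true

-- A function on edges is given as a function on pairs; only its values at
-- (x , y) with x < y are used.  'at f u v' evaluates f at the edge {u,v}.
at : ∀ {n} {B : Set} → (Fin n → Fin n → B) → Fin n → Fin n → B
at f u v = if toℕ u <ᵇ toℕ v then f u v else f v u

Theta : ∀ {n} → Adj n → Fin n × Fin n → Fin n × Fin n → Set
Theta A (u₁ , v₁) (u₂ , v₂) =
  IsEdge A (u₁ , v₁) × IsEdge A (u₂ , v₂) ×
  (dist A u₁ u₂ + dist A v₁ v₂ ≢ dist A u₁ v₂ + dist A u₂ v₁)

ThetaStar : ∀ {n} → Adj n → Fin n × Fin n → Fin n × Fin n → Set
ThetaStar A = TransClosure (Theta A)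

-- The labelling c assigns to each edge (x , y), x < y, the index of its
-- block; blocks E_j = {edges with label j}.  c-partition: every block is
-- nonempty and is a union of Θ*-classes.
IsCPartition : ∀ {n k} → SimpleGraph n → (Fin n → Fin n → Fin k) → Set
IsCPartition {n} {k} G c =
  (∀ j → ∃ λ (e : Fin n × Fin n) → IsEdge (adj G) e × c (proj₁ e) (proj₂ e) ≡ j) ×
  (∀ e f → ThetaStar (adj G) e f → c (proj₁ e) (proj₂ e) ≡ c (proj₁ f) (proj₂ f))

inBlock : ∀ {n k} → (Fin n → Fin n → Fin k) → Fin k → Fin n → Fin n → Bool
inBlock c i x y = ⌊ at c x y ≟ i ⌋

deleteE : ∀ {n} → Adj n → (Fin n → Fin n → Bool) → Adj n
deleteE A Fset x y = A x y ∧ not (at Fset x y)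

-- Quotient graph G/F, described up to naming of its vertices:
-- H is (isomorphic to) G/F via ℓ : V(G) → V(H), where ℓ x = the component
-- of G∖F containing x.

record IsQuotient {n m} (G : SimpleGraph n) (Fset : Fin n → Fin n → Bool)
                  (H : SimpleGraph m) (ℓ : Fin n → Fin m) : Set where
  field
    ℓ-surj : ∀ X → ∃ λ x → ℓ x ≡ X
    ℓ-comp : ∀ x y → (ℓ x ≡ ℓ y) ⇔ (∃ λ k → Walk (deleteE (adj G) Fset) k x y)
    ℓ-adj  : ∀ X Y → (adj H X Y ≡ true) ⇔
               (X ≢ Y × ∃ λ x → ∃ λ y → ℓ x ≡ X × ℓ y ≡ Y × adj G x y ≡ true)

module Weighted {c ℓ'} (M : CommutativeMonoid c ℓ') where
  open CommutativeMonoid M renaming (Carrier to W)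

  ΣV : ∀ {n} → (Fin n → W) → W
  ΣV {zero}  f = ε
  ΣV {suc n} f = f F.zero ∙ ΣV (λ x → f (F.suc x))

  ΣE : ∀ {n} → Adj n → (Fin n → Fin n → W) → W
  ΣE A f = ΣV (λ x → ΣV (λ y → if isEdge A x y then f x y else ε))

  n₀ : ∀ {n} → Adj n → (Fin n → W) → Fin n → Fin n → W
  n₀ A wv u v = ΣV (λ x → if dist A u x ≡ᵇ dist A v x then wv x else ε)

  m₀ : ∀ {n} → Adj n → (Fin n → W) → (Fin n → Fin n → W) → Fin n → Fin n → W
  m₀ A sv se u v =
    ΣV (λ x → if dist A u x ≡ᵇ dist A v x then sv x else ε) ∙
    ΣE A (λ x y → if distE A u x y ≡ᵇ distE A v x y then se x y else ε)

  module _ {n m : ℕ} (G : SimpleGraph n) (Fset : Fin n → Fin n → Bool)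
           (ℓ : Fin n → Fin m) where

    same : Fin n → Fin m → Bool
    same x X = ⌊ ℓ x ≟ X ⌋

    qwv : (Fin n → W) → Fin m → W
    qwv wv X = ΣV (λ x → if same x X then wv x else ε)

    qsv : (Fin n → W) → (Fin n → Fin n → W) → Fin m → W
    qsv sv se X =
      ΣE (deleteE (adj G) Fset) (λ x y → if same x X ∧ same y X then se x y else ε)
      ∙ ΣV (λ x → if same x X then sv x else ε)

    qe : (Fin n → Fin n → W) → Fin m → Fin m → W
    qe we X Y = ΣE (adj G) (λ x y →
      if (same x X ∧ same y Y) ∨ (same x Y ∧ same y X) then we x y else ε)

module Submission where

-- Write F for the block E_i. Because F is a union of Θ*-classes, double counting the Θ-defect
-- θ(ab, yz) = d(a,z) + d(b,y) − d(a,y) − d(b,z) over pairs of edges of a shortest p–x path and of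
-- any p–x walk shows that a shortest path has the fewest F-edges, and likewise the fewest
-- non-F-edges, among all p–x walks. Projecting walks to G/F and lifting them back then gives
-- d_G(p,x) = d_{G/F}(ℓ p, ℓ x) + K(p,x), where K(p,x), the number of non-F-edges of a shortest
-- p–x path, is unchanged when p or x moves along an edge of F. So for uv ∈ F a vertex x is
-- equidistant from u and v iff ℓ x is equidistant from ℓ u and ℓ v; an edge outside F iff its
-- component is; an edge in F iff its quotient edge is. Regrouping the sums defining n₀ and m₀
-- by components and by quotient edges gives the two identities.

open import Defs
open import Data.Nat using (ℕ; zero; suc; _≡ᵇ_; _<ᵇ_; _⊓_)
import Data.Nat as ℕ
import Data.Nat.Properties as ℕₚ
open import Data.Bool using (Bool; true; false; not; _∧_; _∨_; T; if_then_else_)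
open import Data.Bool.Properties using (T-≡; ∧-assoc; ∧-idem; ∧-zeroʳ; if-swap-then; if-∧; if-eta)
open import Data.Fin using (Fin; toℕ; _≟_)
import Data.Fin as F
import Data.Fin.Properties as Finₚ
open import Data.Product using (Σ; _×_; _,_; ∃; ∃₂; proj₁; proj₂)
open import Data.Sum using (_⊎_; inj₁; inj₂)
open import Data.Unit using (⊤; tt)
open import Data.Empty using (⊥-elim)
open import Function.Base using (_⟨_⟩_)
open import Function.Bundles using (Equivalence)
open import Relation.Nullary using (yes; no)
open import Relation.Nullary.Decidable using (⌊_⌋)
open import Relation.Binary.Definitions using (tri<; tri≈; tri>)
open import Relation.Binary.PropositionalEquality using (_≡_; _≢_; refl; sym; trans; cong; cong₂; subst; module ≡-Reasoning)
open import Algebra.Bundles using (CommutativeMonoid)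
import Algebra.Properties.CommutativeSemigroup as CommSemigroupProperties

module Graphs where
  open import Data.Nat using (_+_; _∸_; _≤_; _<_; z≤n; s≤s)
  open import Data.Nat.Induction using (<-wellFounded)
  open import Induction.WellFounded using (Acc; acc)

  ∨-introˡ : ∀ {a b} → a ≡ true → a ∨ b ≡ true
  ∨-introˡ refl = refl

  ∨-introʳ : ∀ {a b} → b ≡ true → a ∨ b ≡ true
  ∨-introʳ {true}  _ = refl
  ∨-introʳ {false} p = p

  ∨-elim : ∀ {a b} → a ∨ b ≡ true → a ≡ true ⊎ b ≡ true
  ∨-elim {true}  _ = inj₁ refl
  ∨-elim {false} p = inj₂ p

  ∧-intro : ∀ {a b} → a ≡ true → b ≡ true → a ∧ b ≡ true
  ∧-intro refl refl = refl

  ∧-elim : ∀ {a b} → a ∧ b ≡ true → a ≡ true × b ≡ true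
  ∧-elim {true} {true} _ = refl , refl

  ≟-refl : ∀ {m} (x : Fin m) → ⌊ x ≟ x ⌋ ≡ true
  ≟-refl x with x ≟ x
  ... | yes _  = refl
  ... | no x≢x = ⊥-elim (x≢x refl)

  ≟-sound : ∀ {m} {x y : Fin m} → ⌊ x ≟ y ⌋ ≡ true → x ≡ y
  ≟-sound {x = x} {y} p with x ≟ y
  ... | yes x≡y = x≡y

  anyF-intro : ∀ {m} (f : Fin m → Bool) x → f x ≡ true → anyF f ≡ true
  anyF-intro f F.zero    p = ∨-introˡ p
  anyF-intro f (F.suc x) p = ∨-introʳ (anyF-intro (λ y → f (F.suc y)) x p)

  anyF-elim : ∀ {m} (f : Fin m → Bool) → anyF f ≡ true → ∃ λ x → f x ≡ true
  anyF-elim {suc m} f p with ∨-elim p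
  ... | inj₁ p₀ = F.zero , p₀
  ... | inj₂ p₁ with anyF-elim (λ y → f (F.suc y)) p₁
  ...   | x , q = F.suc x , q

  <ᵇ-true : ∀ {m n} → m < n → (m <ᵇ n) ≡ true
  <ᵇ-true m<n = Equivalence.to T-≡ (ℕₚ.<⇒<ᵇ m<n)

  <ᵇ-false : ∀ {m n} → n ≤ m → (m <ᵇ n) ≡ false
  <ᵇ-false {m} {n} n≤m with m <ᵇ n in eq
  ... | false = refl
  ... | true  = ⊥-elim (ℕₚ.<⇒≱ (ℕₚ.<ᵇ⇒< m n (subst T (sym eq) tt)) n≤m)

  at-comm : ∀ {n} {B : Set} (f : Fin n → Fin n → B) x y → at f x y ≡ at f y x
  at-comm f x y with ℕₚ.<-cmp (toℕ x) (toℕ y)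
  ... | tri< x<y _ _ rewrite <ᵇ-true x<y | <ᵇ-false (ℕₚ.<⇒≤ x<y) = refl
  ... | tri≈ _ x≡y _ rewrite Finₚ.toℕ-injective x≡y = refl
  ... | tri> _ _ y<x rewrite <ᵇ-true y<x | <ᵇ-false (ℕₚ.<⇒≤ y<x) = refl

  at-symmetric : ∀ {n} {B : Set} (f : Fin n → Fin n → B) → (∀ x y → f x y ≡ f y x) → ∀ x y → at f x y ≡ f x y
  at-symmetric f f-sym x y with toℕ x <ᵇ toℕ y
  ... | true  = refl
  ... | false = f-sym y x

  data Orientation {n} (a b : Fin n) : Fin n → Fin n → Set where
    forward  : Orientation a b a b
    backward : Orientation a b b a

  module _ {n : ℕ} (G : SimpleGraph n) where

    adj-irreflexive : ∀ {a b} → adj G a b ≡ true → a ≢ b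
    adj-irreflexive {a} ab refl with () ← trans (sym ab) (adj-irr G a)

    orient : ∀ {B : Set} (f : Fin n → Fin n → B) {a b} → adj G a b ≡ true →
             ∃₂ λ a′ b′ → Orientation a b a′ b′ × IsEdge (adj G) (a′ , b′) × at f a b ≡ f a′ b′
    orient f {a} {b} ab with ℕₚ.<-cmp (toℕ a) (toℕ b)
    ... | tri< a<b _ _ rewrite <ᵇ-true a<b = a , b , forward , trans (cong (_∧ adj G a b) (<ᵇ-true a<b)) ab , refl
    ... | tri≈ _ a≡b _ = ⊥-elim (adj-irreflexive ab (Finₚ.toℕ-injective a≡b))
    ... | tri> _ _ b<a rewrite <ᵇ-false (ℕₚ.<⇒≤ b<a) =
      b , a , backward , trans (cong (_∧ adj G b a) (<ᵇ-true b<a)) (trans (adj-sym G b a) ab) , refl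

  module _ {n : ℕ} {A : Adj n} where

    infixr 5 _++ʷ_
    _++ʷ_ : ∀ {j k x y z} → Walk A j x y → Walk A k y z → Walk A (j + k) x z
    here     ++ʷ w = w
    step e p ++ʷ w = step e (p ++ʷ w)

    _∷ʳ_ : ∀ {k x y z} → Walk A k x y → A y z ≡ true → Walk A (suc k) x z
    _∷ʳ_ {k} {x} {z = z} w e = subst (λ L → Walk A L x z) (ℕₚ.+-comm k 1) (w ++ʷ step e here)

    vertexAt : ∀ {L x y} → Walk A L x y → Fin (suc L) → Fin n
    vertexAt {x = x} w          F.zero    = x
    vertexAt         (step e w) (F.suc i) = vertexAt w i

    prefix : ∀ {L x y} (w : Walk A L x y) (i : Fin (suc L)) → Walk A (toℕ i) x (vertexAt w i)
    prefix w          F.zero    = here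
    prefix (step e w) (F.suc i) = step e (prefix w i)

    suffix : ∀ {L x y} (w : Walk A L x y) (i : Fin (suc L)) → Walk A (L ∸ toℕ i) (vertexAt w i) y
    suffix w          F.zero    = w
    suffix (step e w) (F.suc i) = suffix w i

    -- A walk with at least n steps visits some vertex twice; cut out the closed subwalk.
    shortcut : ∀ {L x y} → Walk A L x y → n ≤ L → ∃ λ L′ → L′ < L × Walk A L′ x y
    shortcut {L} w n≤L with Finₚ.pigeonhole (s≤s n≤L) (vertexAt w)
    ... | i , j , i<j , wᵢ≡wⱼ =
      toℕ i + (L ∸ toℕ j) , shorter ,
      prefix w i ++ʷ subst (λ z → Walk A (L ∸ toℕ j) z _) (sym wᵢ≡wⱼ) (suffix w j)
      where
        open ℕₚ.≤-Reasoning
        shorter : toℕ i + (L ∸ toℕ j) < L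
        shorter = begin-strict
          toℕ i + (L ∸ toℕ j) <⟨ ℕₚ.+-monoˡ-< (L ∸ toℕ j) i<j ⟩
          toℕ j + (L ∸ toℕ j) ≡⟨ ℕₚ.m+[n∸m]≡n (ℕₚ.≤-pred (Finₚ.toℕ<n j)) ⟩
          L                   ∎

    shorten : ∀ {L x y} → Walk A L x y → ∃ λ L′ → L′ < n × Walk A L′ x y
    shorten w = go (<-wellFounded _) w
      where
        go : ∀ {L x y} → Acc _<_ L → Walk A L x y → ∃ λ L′ → L′ < n × Walk A L′ x y
        go {L} (acc rec) w with n ℕ.≤? L
        ... | no  n≰L = L , ℕₚ.≰⇒> n≰L , w
        ... | yes n≤L with shortcut w n≤L
        ...   | L′ , L′<L , w′ = go (rec L′<L) w′

    reverse : (∀ x y → A x y ≡ A y x) → ∀ {k x y} → Walk A k x y → Walk A k y x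
    reverse A-sym here                   = here
    reverse A-sym (step {x = x} {y} e w) = reverse A-sym w ∷ʳ trans (A-sym y x) e

  module _ {n : ℕ} (A : Adj n) where

    reach-∷ʳ : ∀ k {u w v} → reach A k u w ≡ true → A w v ≡ true → reach A (suc k) u v ≡ true
    reach-∷ʳ k {u} {w} {v} r e = ∨-introʳ (anyF-intro (λ w → reach A k u w ∧ A w v) w (∧-intro r e))

    reach-∷ : ∀ k {u y v} → A u y ≡ true → reach A k y v ≡ true → reach A (suc k) u v ≡ true
    reach-∷ zero    {u} e r with ≟-sound r
    ... | refl = reach-∷ʳ 0 (≟-refl u) e
    reach-∷ (suc k) {u} {y} {v} e r with ∨-elim r
    ... | inj₁ r′ = ∨-introˡ (reach-∷ k e r′)
    ... | inj₂ r′ with anyF-elim (λ w → reach A k y w ∧ A w v) r′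
    ...   | w , q = reach-∷ʳ (suc k) (reach-∷ k e (proj₁ (∧-elim q))) (proj₂ (∧-elim q))

    walk⇒reach : ∀ {k u v} → Walk A k u v → reach A k u v ≡ true
    walk⇒reach {u = u} here = ≟-refl u
    walk⇒reach (step {k} e w) = reach-∷ k e (walk⇒reach w)

    reach⇒walk : ∀ k {u v} → reach A k u v ≡ true → ∃ λ j → j ≤ k × Walk A j u v
    reach⇒walk zero r with ≟-sound r
    ... | refl = 0 , z≤n , here
    reach⇒walk (suc k) r with ∨-elim r
    ... | inj₁ r′ with reach⇒walk k r′
    ...   | j , j≤k , w = j , ℕₚ.m≤n⇒m≤1+n j≤k , w
    reach⇒walk (suc k) {u} {v} r | inj₂ r′ with anyF-elim (λ w → reach A k u w ∧ A w v) r′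
    ...   | w , q with reach⇒walk k (proj₁ (∧-elim q))
    ...     | j , j≤k , p = suc j , s≤s j≤k , p ∷ʳ proj₂ (∧-elim q)

    IsLeastReach : Fin n → Fin n → ℕ → Set
    IsLeastReach u v d = reach A d u v ≡ true × (∀ j → j < d → reach A j u v ≡ false)

    distFrom-least : ∀ u v f k → (∀ j → j < k → reach A j u v ≡ false) →
                     (∃ λ j → j < k + f × reach A j u v ≡ true) → IsLeastReach u v (distFrom A u v f k)
    distFrom-least u v zero k below (j , j<k+0 , r)
      with () ← trans (sym (below j (subst (j <_) (ℕₚ.+-identityʳ k) j<k+0))) r
    distFrom-least u v (suc f) k below found with reach A k u v in eq
    ... | true  = eq , below
    ... | false = distFrom-least u v f (suc k) below′ found′
      where
        below′ : ∀ j → j < suc k → reach A j u v ≡ false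
        below′ j (s≤s j≤k) with ℕₚ.m≤n⇒m<n∨m≡n j≤k
        ... | inj₁ j<k  = below j j<k
        ... | inj₂ refl = eq
        found′ : ∃ λ j → j < suc k + f × reach A j u v ≡ true
        found′ = let j , j<k+sf , r = found in j , subst (j <_) (ℕₚ.+-suc k f) j<k+sf , r

  module _ {n : ℕ} {A : Adj n} where

    AllSteps : (Fin n → Fin n → Set) → ∀ {L x y} → Walk A L x y → Set
    AllSteps R here                       = ⊤
    AllSteps R (step {x = a} {y = b} e w) = R a b × AllSteps R w

    allSteps : ∀ {R : Fin n → Fin n → Set} → (∀ a b → A a b ≡ true → R a b) →
               ∀ {L x y} (w : Walk A L x y) → AllSteps R w
    allSteps R-adj here                       = tt
    allSteps R-adj (step {x = a} {y = b} e w) = R-adj a b e , allSteps R-adj w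

    allSteps-map : ∀ {R S : Fin n → Fin n → Set} → (∀ {a b} → A a b ≡ true → R a b → S a b) →
                   ∀ {L x y} (w : Walk A L x y) → AllSteps R w → AllSteps S w
    allSteps-map f here       _            = tt
    allSteps-map f (step e w) (r , rs) = f e r , allSteps-map f w rs

  squeeze : ∀ {a b c e} → a ≤ c → b ≤ e → c + e ≤ a + b → a ≡ c × b ≡ e
  squeeze {a} {b} {c} {e} a≤c b≤e c+e≤a+b =
    ℕₚ.≤-antisym a≤c (ℕₚ.+-cancelʳ-≤ e c a (ℕₚ.≤-trans c+e≤a+b (ℕₚ.+-monoʳ-≤ a b≤e))) ,
    ℕₚ.≤-antisym b≤e (ℕₚ.+-cancelˡ-≤ c e b (ℕₚ.≤-trans c+e≤a+b (ℕₚ.+-monoˡ-≤ b a≤c)))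

  module Metric {n : ℕ} (G : SimpleGraph n) (connected : Connected G) where

    d : Fin n → Fin n → ℕ
    d = dist (adj G)

    dist-least : ∀ u v → IsLeastReach (adj G) u v (d u v)
    dist-least u v with connected u v
    ... | _ , w with shorten w
    ...   | L , L<n , w′ = distFrom-least (adj G) u v n 0 (λ _ ()) (L , L<n , walk⇒reach (adj G) w′)

    dist-≤-length : ∀ {L u v} → Walk (adj G) L u v → d u v ≤ L
    dist-≤-length {L} {u} {v} w with d u v ℕ.≤? L
    ... | yes d≤L = d≤L
    ... | no  d≰L with () ← trans (sym (proj₂ (dist-least u v) L (ℕₚ.≰⇒> d≰L))) (walk⇒reach (adj G) w)

    geodesic : ∀ u v → Walk (adj G) (d u v) u v
    geodesic u v with reach⇒walk (adj G) (d u v) (proj₁ (dist-least u v))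
    ... | j , j≤d , w with ℕₚ.≤-antisym j≤d (dist-≤-length w)
    ...   | refl = w

    dist-refl : ∀ u → d u u ≡ 0
    dist-refl u = ℕₚ.n≤0⇒n≡0 (dist-≤-length here)

    dist-sym : ∀ u v → d u v ≡ d v u
    dist-sym u v = ℕₚ.≤-antisym (dist-≤-length (reverse (adj-sym G) (geodesic v u)))
                                (dist-≤-length (reverse (adj-sym G) (geodesic u v)))

    dist-triangle : ∀ u v w → d u w ≤ d u v + d v w
    dist-triangle u v w = dist-≤-length (geodesic u v ++ʷ geodesic v w)

    dist-adj : ∀ u {x y} → adj G x y ≡ true → d u y ≤ suc (d u x)
    dist-adj u e = dist-≤-length (geodesic u _ ∷ʳ e)

    -- The hypothesis says that q lies on a shortest p–x path and that w is a shortest q–x walk.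
    tight-walk-steps : ∀ p {L q x} (w : Walk (adj G) L q x) → d p q + L ≡ d p x →
                     AllSteps (λ a b → d p b ≡ suc (d p a) × d a x ≡ suc (d b x)) w
    tight-walk-steps p here                                  _     = tt
    tight-walk-steps p {suc L} {q} {x} (step {y = b} e w) tight =
      (dpb≡ , dqx≡) , tight-walk-steps p w tight′
      where
        open ℕₚ.≤-Reasoning
        lower : suc (d p q) + L ≤ d p b + d b x
        lower = begin
          suc (d p q) + L ≡⟨ ℕₚ.+-suc (d p q) L ⟨
          d p q + suc L   ≡⟨ tight ⟩
          d p x           ≤⟨ dist-triangle p b x ⟩
          d p b + d b x   ∎
        squeezed = squeeze (dist-adj p e) (dist-≤-length w) lower
        dpb≡ = proj₁ squeezed
        dbx≡ = proj₂ squeezed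
        tight′ : d p b + L ≡ d p x
        tight′ = trans (cong (_+ L) dpb≡) (trans (sym (ℕₚ.+-suc (d p q) L)) tight)
        suc-L≤dqx : suc L ≤ d q x
        suc-L≤dqx = ℕₚ.+-cancelˡ-≤ (d p q) (suc L) (d q x)
                      (ℕₚ.≤-trans (ℕₚ.≤-reflexive tight) (dist-triangle p q x))
        dqx≡ : d q x ≡ suc (d b x)
        dqx≡ = trans (ℕₚ.≤-antisym (dist-≤-length (step e w)) suc-L≤dqx) (cong suc (sym dbx≡))

    geodesic-steps : ∀ p x → AllSteps (λ a b → d p b ≡ suc (d p a) × d a x ≡ suc (d b x)) (geodesic p x)
    geodesic-steps p x = tight-walk-steps p (geodesic p x) (cong (_+ d p x) (dist-refl p))

open Graphs

module ThetaClasses where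
  open import Data.Integer using (ℤ; +_; 0ℤ; _+_; _-_; _*_; -_; _≤_; +≤+)
  open import Data.Integer.Properties
    using (+-identityˡ; +-mono-≤; +-monoˡ-≤; +-inverseʳ; pos-+; *-comm; *-identityˡ; *-zeroʳ; *-distribˡ-+;
           ≤-refl; ≤-trans; ≤-reflexive; drop‿+≤+; *-cancelˡ-≤-pos; *-monoˡ-≤-nonNeg; neg-involutive; module ≤-Reasoning)
    renaming (_≟_ to _≟ℤ_)
  open import Data.Integer.Tactic.RingSolver using (solve-∀)
  open import Relation.Binary.Construct.Closure.Transitive using ([_])

  module _ {n : ℕ} {A : Adj n} where

    walkSum : ∀ {L x y} → Walk A L x y → (Fin n → Fin n → ℤ) → ℤ
    walkSum here                       f = 0ℤ
    walkSum (step {x = a} {y = b} e w) f = f a b + walkSum w f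

    walkSum-cong : ∀ {L x y} (w : Walk A L x y) {f g : Fin n → Fin n → ℤ} →
                   AllSteps (λ a b → f a b ≡ g a b) w → walkSum w f ≡ walkSum w g
    walkSum-cong here       _          = refl
    walkSum-cong (step e w) (eq , eqs) = cong₂ _+_ eq (walkSum-cong w eqs)

    walkSum-mono : ∀ {L x y} (w : Walk A L x y) {f g : Fin n → Fin n → ℤ} →
                   AllSteps (λ a b → f a b ≤ g a b) w → walkSum w f ≤ walkSum w g
    walkSum-mono here       _          = ≤-refl
    walkSum-mono (step e w) (le , les) = +-mono-≤ le (walkSum-mono w les)

    walkSum-zero : ∀ {L x y} (w : Walk A L x y) → walkSum w (λ _ _ → 0ℤ) ≡ 0ℤ
    walkSum-zero here       = refl
    walkSum-zero (step e w) = trans (+-identityˡ _) (walkSum-zero w)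

    walkSum-+ : ∀ {L x y} (w : Walk A L x y) (f g : Fin n → Fin n → ℤ) →
                walkSum w (λ a b → f a b + g a b) ≡ walkSum w f + walkSum w g
    walkSum-+ here                       f g = refl
    walkSum-+ (step {x = a} {y = b} e w) f g =
      trans (cong (_+_ (f a b + g a b)) (walkSum-+ w f g)) (interchange (f a b) (g a b) _ _)
      where
        interchange : ∀ p q r s → (p + q) + (r + s) ≡ (p + r) + (q + s)
        interchange = solve-∀

    walkSum-*ˡ : ∀ {L x y} (w : Walk A L x y) (c : ℤ) (f : Fin n → Fin n → ℤ) →
                 walkSum w (λ a b → c * f a b) ≡ c * walkSum w f
    walkSum-*ˡ here                       c f = sym (*-zeroʳ c)
    walkSum-*ˡ (step {x = a} {y = b} e w) c f =
      trans (cong (_+_ (c * f a b)) (walkSum-*ˡ w c f)) (sym (*-distribˡ-+ c (f a b) (walkSum w f)))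

    walkSum-telescope : ∀ {L x y} (w : Walk A L x y) (g : Fin n → ℤ) →
                        walkSum w (λ a b → g b - g a) ≡ g y - g x
    walkSum-telescope {y = y} here g = sym (+-inverseʳ (g y))
    walkSum-telescope (step {x = a} {y = b} {z = c} e w) g =
      trans (cong (_+_ (g b - g a)) (walkSum-telescope w g)) (chain (g a) (g b) (g c))
      where
        chain : ∀ p q r → (q - p) + (r - q) ≡ r - p
        chain = solve-∀

    walkSum-comm : ∀ {L x y L′ x′ y′} (v : Walk A L x y) (w : Walk A L′ x′ y′)
                   (f : Fin n → Fin n → Fin n → Fin n → ℤ) →
                   walkSum v (λ a b → walkSum w (f a b)) ≡ walkSum w (λ c e → walkSum v (λ a b → f a b c e))
    walkSum-comm here                       w f = sym (walkSum-zero w)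
    walkSum-comm (step {x = a} {y = b} e v) w f =
      trans (cong (_+_ (walkSum w (f a b))) (walkSum-comm v w f))
            (sym (walkSum-+ w (f a b) (λ c e → walkSum v (λ a b → f a b c e))))

  𝟙 : Bool → ℕ
  𝟙 true  = 1
  𝟙 false = 0

  χ : Bool → ℤ
  χ b = + 𝟙 b

  module _ {n : ℕ} {A : Adj n} where

    count : (Fin n → Fin n → Bool) → ∀ {L x y} → Walk A L x y → ℕ
    count P here                       = 0
    count P (step {x = a} {y = b} e w) = 𝟙 (P a b) ℕ.+ count P w

    walkSum-count : ∀ (P : Fin n → Fin n → Bool) {L x y} (w : Walk A L x y) →
                    walkSum w (λ a b → χ (P a b)) ≡ + count P w
    walkSum-count P here                       = refl
    walkSum-count P (step {x = a} {y = b} e w) =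
      trans (cong (_+_ (χ (P a b))) (walkSum-count P w)) (sym (pos-+ (𝟙 (P a b)) (count P w)))

    walkSum-χ* : ∀ (P : Fin n → Fin n → Bool) (c : ℤ) {L x y} (w : Walk A L x y) →
                 walkSum w (λ a b → χ (P a b) * c) ≡ c * + count P w
    walkSum-χ* P c w = begin
      walkSum w (λ a b → χ (P a b) * c) ≡⟨ walkSum-cong w (allSteps (λ a b _ → *-comm (χ (P a b)) c) w) ⟩
      walkSum w (λ a b → c * χ (P a b)) ≡⟨ walkSum-*ˡ w c (λ a b → χ (P a b)) ⟩
      c * walkSum w (λ a b → χ (P a b)) ≡⟨ cong (c *_) (walkSum-count P w) ⟩
      c * + count P w                   ∎
      where open ≡-Reasoning

  χ-idem : ∀ b t → χ b * (χ b * t) ≡ χ b * t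
  χ-idem true  t = cong (χ true *_) (*-identityˡ t)
  χ-idem false t = refl

  χ-absorbˡ : ∀ b c t → (t ≢ 0ℤ → b ≡ c) → χ b * (χ c * t) ≡ χ b * t
  χ-absorbˡ b c t agree with t ≟ℤ 0ℤ
  ... | yes refl = cong (χ b *_) (*-zeroʳ (χ c))
  ... | no  t≢0  rewrite agree t≢0 = χ-idem c t

  χ-absorbʳ : ∀ b c t → (t ≢ 0ℤ → b ≡ c) → χ b * (χ c * t) ≡ χ c * t
  χ-absorbʳ b c t agree with t ≟ℤ 0ℤ
  ... | yes refl = trans (cong (χ b *_) (*-zeroʳ (χ c))) (trans (*-zeroʳ (χ b)) (sym (*-zeroʳ (χ c))))
  ... | no  t≢0  rewrite agree t≢0 = χ-idem c t

  difference-≤ : ∀ i j k → i ≤ k + j → i - j ≤ k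
  difference-≤ i j k i≤k+j = ≤-trans (+-monoˡ-≤ (- j) i≤k+j) (≤-reflexive (cancel k j))
    where
      cancel : ∀ k j → (k + j) - j ≡ k
      cancel = solve-∀

  module ThetaCounting {n : ℕ} (G : SimpleGraph n) (connected : Connected G) where
    open Metric G connected

    -- Zero exactly when d(a,y) + d(b,z) = d(a,z) + d(b,y), i.e. when ab and yz are not in relation Θ.
    θ : Fin n → Fin n → Fin n → Fin n → ℤ
    θ a b y z = (+ d b y - + d a y) - (+ d b z - + d a z)

    Θ-Closed : (Fin n → Fin n → Bool) → Set
    Θ-Closed P = ∀ {a b y z} → adj G a b ≡ true → adj G y z ≡ true → θ a b y z ≢ 0ℤ → P a b ≡ P y z

    θ-geodesic : ∀ p x → AllSteps (λ a b → θ a b p x ≡ + 2) (geodesic p x)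
    θ-geodesic p x = allSteps-map value (geodesic p x) (geodesic-steps p x)
      where
        two : ∀ s t → ((+ 1 + s) - s) - (t - (+ 1 + t)) ≡ + 2
        two = solve-∀
        value : ∀ {a b} → adj G a b ≡ true → d p b ≡ suc (d p a) × d a x ≡ suc (d b x) → θ a b p x ≡ + 2
        value {a} {b} _ (dpb , dax) rewrite dist-sym b p | dist-sym a p | dpb | dax = two (+ d p a) (+ d b x)

    θ-row : ∀ a b {L p x} (w : Walk (adj G) L p x) → walkSum w (θ a b) ≡ θ a b p x
    θ-row a b {p = p} {x} w = begin
      walkSum w (θ a b)             ≡⟨ walkSum-cong w (allSteps (λ y z _ → rearrange (dz a y) (dz b y) (dz a z) (dz b z)) w) ⟩
      walkSum w (λ y z → g z - g y) ≡⟨ walkSum-telescope w g ⟩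
      g x - g p                     ≡⟨ rearrange (dz a p) (dz b p) (dz a x) (dz b x) ⟨
      θ a b p x                     ∎
      where
        open ≡-Reasoning
        dz : Fin n → Fin n → ℤ
        dz s t = + d s t
        g : Fin n → ℤ
        g y = dz a y - dz b y
        rearrange : ∀ ay by az bz → (by - ay) - (bz - az) ≡ (az - bz) - (ay - by)
        rearrange = solve-∀

    θ-column : ∀ {L p x} (w : Walk (adj G) L p x) {y z} → adj G y z ≡ true →
               walkSum w (λ a b → θ a b y z) ≤ + 2
    θ-column {p = p} {x} w {y} {z} yz = begin
      walkSum w (λ a b → θ a b y z) ≡⟨ walkSum-cong w (allSteps (λ a b _ → rearrange (dz a y) (dz b y) (dz a z) (dz b z)) w) ⟩
      walkSum w (λ a b → h b - h a) ≡⟨ walkSum-telescope w h ⟩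
      h x - h p                     ≡⟨ rearrange₂ (dz x y) (dz x z) (dz p y) (dz p z) ⟩
      (dz x y + dz p z) - (dz x z + dz p y) ≤⟨ difference-≤ (dz x y + dz p z) (dz x z + dz p y) (+ 2) (+≤+ bound) ⟩
      + 2                                   ∎
      where
        open ≤-Reasoning
        dz : Fin n → Fin n → ℤ
        dz s t = + d s t
        h : Fin n → ℤ
        h a = dz a y - dz a z
        rearrange : ∀ ay by az bz → (by - ay) - (bz - az) ≡ (by - bz) - (ay - az)
        rearrange = solve-∀
        rearrange₂ : ∀ xy xz py pz → (xy - xz) - (py - pz) ≡ (xy + pz) - (xz + py)
        rearrange₂ = solve-∀
        bound : d x y ℕ.+ d p z ℕ.≤ 2 ℕ.+ (d x z ℕ.+ d p y)
        bound = ℕₚ.≤-trans (ℕₚ.+-mono-≤ (dist-adj x (trans (adj-sym G z y) yz)) (dist-adj p yz))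
                           (ℕₚ.≤-reflexive (cong suc (ℕₚ.+-suc (d x z) (d p y))))

    -- Double counting Σ_{ab ∈ geodesic} Σ_{yz ∈ W} [P ab] [P yz] θ(ab, yz): summing rows first
    -- gives 2·count P geodesic, summing columns first gives at most 2·count P W.
    geodesic-minimises-count : ∀ P → Θ-Closed P → ∀ p x {L} (W : Walk (adj G) L p x) →
                               count P (geodesic p x) ℕ.≤ count P W
    geodesic-minimises-count P closed p x W =
      drop‿+≤+ (*-cancelˡ-≤-pos (+ count P γ) (+ count P W) (+ 2) (begin
        + 2 * + count P γ ≡⟨ rows ⟨
        S                 ≡⟨ walkSum-comm γ W ψ ⟩
        walkSum W (λ y z → walkSum γ (λ a b → ψ a b y z)) ≤⟨ columns ⟩
        + 2 * + count P W ∎))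
      where
        open ≤-Reasoning
        γ = geodesic p x
        ψ : Fin n → Fin n → Fin n → Fin n → ℤ
        ψ a b y z = χ (P a b) * (χ (P y z) * θ a b y z)
        S = walkSum γ (λ a b → walkSum W (ψ a b))
        row : ∀ {a b} → adj G a b ≡ true → θ a b p x ≡ + 2 → walkSum W (ψ a b) ≡ χ (P a b) * + 2
        row {a} {b} ab θ≡2 = begin-equality
          walkSum W (ψ a b)
            ≡⟨ walkSum-cong W (allSteps (λ y z yz → χ-absorbˡ (P a b) (P y z) _ (closed ab yz)) W) ⟩
          walkSum W (λ y z → χ (P a b) * θ a b y z) ≡⟨ walkSum-*ˡ W (χ (P a b)) (θ a b) ⟩
          χ (P a b) * walkSum W (θ a b)             ≡⟨ cong (χ (P a b) *_) (trans (θ-row a b W) θ≡2) ⟩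
          χ (P a b) * + 2                           ∎
        rows : S ≡ + 2 * + count P γ
        rows = trans (walkSum-cong γ (allSteps-map row γ (θ-geodesic p x))) (walkSum-χ* P (+ 2) γ)
        column : ∀ {y z} → adj G y z ≡ true → walkSum γ (λ a b → ψ a b y z) ≤ χ (P y z) * + 2
        column {y} {z} yz = begin
          walkSum γ (λ a b → ψ a b y z)
            ≡⟨ walkSum-cong γ (allSteps (λ a b ab → χ-absorbʳ (P a b) (P y z) _ (closed ab yz)) γ) ⟩
          walkSum γ (λ a b → χ (P y z) * θ a b y z) ≡⟨ walkSum-*ˡ γ (χ (P y z)) (λ a b → θ a b y z) ⟩
          χ (P y z) * walkSum γ (λ a b → θ a b y z) ≤⟨ *-monoˡ-≤-nonNeg (χ (P y z)) (θ-column γ yz) ⟩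
          χ (P y z) * + 2                           ∎
        columns : walkSum W (λ y z → walkSum γ (λ a b → ψ a b y z)) ≤ + 2 * + count P W
        columns = ≤-trans (walkSum-mono W (allSteps (λ y z yz → column yz) W)) (≤-reflexive (walkSum-χ* P (+ 2) W))

  module Blocks {n k : ℕ} (G : SimpleGraph n) (connected : Connected G)
                (c : Fin n → Fin n → Fin k) (c-partition : IsCPartition G c) where
    open Metric G connected
    open ThetaCounting G connected

    θ-zero : ∀ {a b y z} → d a y ℕ.+ d b z ≡ d a z ℕ.+ d b y → θ a b y z ≡ 0ℤ
    θ-zero {a} {b} {y} {z} eq = begin
      θ a b y z                                 ≡⟨ regroup (+ d a y) (+ d b y) (+ d a z) (+ d b z) ⟩
      + (d a z ℕ.+ d b y) - + (d a y ℕ.+ d b z) ≡⟨ cong (λ t → + (d a z ℕ.+ d b y) - + t) eq ⟩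
      + (d a z ℕ.+ d b y) - + (d a z ℕ.+ d b y) ≡⟨ +-inverseʳ (+ (d a z ℕ.+ d b y)) ⟩
      0ℤ                                        ∎
      where
        open ≡-Reasoning
        regroup : ∀ ay by az bz → (by - ay) - (bz - az) ≡ (az + by) - (ay + bz)
        regroup = solve-∀

    θ-swapˡ : ∀ a b y z → θ b a y z ≡ - θ a b y z
    θ-swapˡ a b y z = swap (+ d a y) (+ d b y) (+ d a z) (+ d b z)
      where
        swap : ∀ ay by az bz → (ay - by) - (az - bz) ≡ - ((by - ay) - (bz - az))
        swap = solve-∀

    θ-swapʳ : ∀ a b y z → θ a b z y ≡ - θ a b y z
    θ-swapʳ a b y z = swap (+ d a y) (+ d b y) (+ d a z) (+ d b z)
      where
        swap : ∀ ay by az bz → (bz - az) - (by - ay) ≡ - ((by - ay) - (bz - az))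
        swap = solve-∀

    negation-zero : ∀ {t} → - t ≡ 0ℤ → t ≡ 0ℤ
    negation-zero {t} -t≡0 = trans (sym (neg-involutive t)) (cong -_ -t≡0)

    θ-reorient : ∀ {a b a′ b′ y z y′ z′} → Orientation a b a′ b′ → Orientation y z y′ z′ →
                 θ a′ b′ y′ z′ ≡ 0ℤ → θ a b y z ≡ 0ℤ
    θ-reorient forward  forward  θ′≡0 = θ′≡0
    θ-reorient {a} {b} {y = y} {z} backward forward θ′≡0 = negation-zero (trans (sym (θ-swapˡ a b y z)) θ′≡0)
    θ-reorient {a} {b} {y = y} {z} forward backward θ′≡0 = negation-zero (trans (sym (θ-swapʳ a b y z)) θ′≡0)
    θ-reorient backward backward θ′≡0 = θ-reorient forward backward (θ-reorient backward forward θ′≡0)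

    -- Θ is stated for edges listed with their smaller end first; reorienting an edge only negates θ.
    at-c-Θ-closed : ∀ {a b y z} → adj G a b ≡ true → adj G y z ≡ true → θ a b y z ≢ 0ℤ → at c a b ≡ at c y z
    at-c-Θ-closed ab yz θ≢0 with orient G c ab | orient G c yz
    ... | a′ , b′ , o₁ , e₁ , c₁ | y′ , z′ , o₂ , e₂ , c₂ =
      trans c₁ (trans (proj₂ c-partition (a′ , b′) (y′ , z′) [ e₁ , e₂ , Θ-related ]) (sym c₂))
      where
        Θ-related : d a′ y′ ℕ.+ d b′ z′ ≢ d a′ z′ ℕ.+ d y′ b′
        Θ-related eq = θ≢0 (θ-reorient o₁ o₂ (θ-zero (trans eq (cong (d a′ z′ ℕ.+_) (dist-sym y′ b′)))))

    inBlock-Θ-closed : ∀ i → Θ-Closed (inBlock c i)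
    inBlock-Θ-closed i ab yz θ≢0 = cong (λ t → ⌊ t ≟ i ⌋) (at-c-Θ-closed ab yz θ≢0)

    outBlock-Θ-closed : ∀ i → Θ-Closed (λ a b → not (inBlock c i a b))
    outBlock-Θ-closed i ab yz θ≢0 = cong not (inBlock-Θ-closed i ab yz θ≢0)

open ThetaClasses

module QuotientDistances where
  open import Data.Nat using (_+_; _≤_; z≤n; s≤s)
  open import Data.Nat.Tactic.RingSolver using (solve-∀)

  𝟙≤1 : ∀ b → 𝟙 b ≤ 1
  𝟙≤1 true  = s≤s z≤n
  𝟙≤1 false = z≤n

  𝟙-split : ∀ b → 𝟙 b + 𝟙 (not b) ≡ 1
  𝟙-split true  = refl
  𝟙-split false = refl

  module _ {n : ℕ} {A : Adj n} where

    count-++ : ∀ P {j l p q r} (v : Walk A j p q) (w : Walk A l q r) → count P (v ++ʷ w) ≡ count P v + count P w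
    count-++ P here                       w = refl
    count-++ P (step {x = a} {y = b} e v) w =
      trans (cong (𝟙 (P a b) +_) (count-++ P v w)) (sym (ℕₚ.+-assoc (𝟙 (P a b)) (count P v) (count P w)))

    count-complement : ∀ P {L p q} (w : Walk A L p q) → count P w + count (λ a b → not (P a b)) w ≡ L
    count-complement P here                       = refl
    count-complement P {suc L} (step {x = a} {y = b} e w) =
      trans (interchange (𝟙 (P a b)) (count P w) (𝟙 (not (P a b))) (count (λ a b → not (P a b)) w))
            (cong₂ _+_ (𝟙-split (P a b)) (count-complement P w))
      where
        interchange : ∀ p q r s → (p + q) + (r + s) ≡ (p + r) + (q + s)
        interchange = solve-∀

    count-single-step : ∀ P {L x y} (w : Walk A L x y) → L ≤ 1 → x ≢ y → count P w ≡ 𝟙 (P x y)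
    count-single-step P here                _         x≢x = ⊥-elim (x≢x refl)
    count-single-step P (step e here)       _         _   = ℕₚ.+-identityʳ _
    count-single-step P (step e (step _ _)) (s≤s ()) _

  ≡ᵇ-cancelˡ : ∀ κ a b → (κ + a ≡ᵇ κ + b) ≡ (a ≡ᵇ b)
  ≡ᵇ-cancelˡ zero    a b = refl
  ≡ᵇ-cancelˡ (suc κ) a b = ≡ᵇ-cancelˡ κ a b

  ≡ᵇ-cancelʳ : ∀ a b κ → (a + κ ≡ᵇ b + κ) ≡ (a ≡ᵇ b)
  ≡ᵇ-cancelʳ a b κ = trans (cong₂ _≡ᵇ_ (ℕₚ.+-comm a κ) (ℕₚ.+-comm b κ)) (≡ᵇ-cancelˡ κ a b)

  module QuotientMetric {n m k : ℕ} (G : SimpleGraph n) (connected : Connected G)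
                        (c : Fin n → Fin n → Fin k) (c-partition : IsCPartition G c) (i : Fin k)
                        (H : SimpleGraph m) (ℓ : Fin n → Fin m) (quotient : IsQuotient G (inBlock c i) H ℓ) where
    open Metric G connected
    open ThetaCounting G connected
    open Blocks G connected c c-partition
    open IsQuotient quotient
    open Equivalence

    F : Fin n → Fin n → Bool
    F = inBlock c i

    Fᶜ : Fin n → Fin n → Bool
    Fᶜ a b = not (F a b)

    F-sym : ∀ a b → F a b ≡ F b a
    F-sym a b = cong (λ t → ⌊ t ≟ i ⌋) (at-comm c a b)

    deleteE-intro : ∀ {a b} → adj G a b ≡ true → F a b ≡ false → deleteE (adj G) F a b ≡ true
    deleteE-intro {a} {b} ab Fab rewrite at-symmetric F F-sym a b | ab | Fab = refl

    deleteE-elim : ∀ {a b} → deleteE (adj G) F a b ≡ true → adj G a b ≡ true × F a b ≡ false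
    deleteE-elim {a} {b} del rewrite at-symmetric F F-sym a b with adj G a b | F a b | del
    ... | true | false | _ = refl , refl

    isEdge-deleteE : ∀ x y → isEdge (deleteE (adj G) F) x y ≡ isEdge (adj G) x y ∧ not (F x y)
    isEdge-deleteE x y = trans (cong (λ t → (toℕ x ℕ.<ᵇ toℕ y) ∧ (adj G x y ∧ not t)) (at-symmetric F F-sym x y))
                               (sym (∧-assoc (toℕ x ℕ.<ᵇ toℕ y) (adj G x y) (not (F x y))))

    ℓ-outside-block : ∀ {a b} → adj G a b ≡ true → F a b ≡ false → ℓ a ≡ ℓ b
    ℓ-outside-block ab Fab = from (ℓ-comp _ _) (1 , step (deleteE-intro ab Fab) here)

    inside-block : ∀ {a b} → adj G a b ≡ true → ℓ a ≢ ℓ b → F a b ≡ true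
    inside-block {a} {b} ab ℓa≢ℓb with F a b in Fab
    ... | true  = refl
    ... | false = ⊥-elim (ℓa≢ℓb (ℓ-outside-block ab Fab))

    project : ∀ {L p x} (W : Walk (adj G) L p x) → ∃ λ j → j ≤ count F W × Walk (adj H) j (ℓ p) (ℓ x)
    project here = 0 , z≤n , here
    project (step {x = a} {y = b} {z = x} ab w) with project w | ℓ a ≟ ℓ b
    ... | j , j≤ , w′ | yes ℓa≡ℓb =
      j , ℕₚ.≤-trans j≤ (ℕₚ.m≤n+m _ _) , subst (λ X → Walk (adj H) j X (ℓ x)) (sym ℓa≡ℓb) w′
    ... | j , j≤ , w′ | no ℓa≢ℓb =
      suc j , subst (λ t → suc j ≤ 𝟙 t + count F w) (sym (inside-block ab ℓa≢ℓb)) (s≤s j≤) ,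
      step (from (ℓ-adj (ℓ a) (ℓ b)) (ℓa≢ℓb , a , b , refl , refl , ab)) w′

    unfold-component : ∀ {L p x} → Walk (deleteE (adj G) F) L p x → Σ (Walk (adj G) L p x) λ W → count F W ≡ 0
    unfold-component here = here , refl
    unfold-component (step {x = a} {y = b} del w) with deleteE-elim del | unfold-component w
    ... | ab , Fab | W , count≡0 = step ab W , trans (cong (λ t → 𝟙 t + count F W) Fab) count≡0

    lift : ∀ {j X Y} → Walk (adj H) j X Y → ∀ {p x} → ℓ p ≡ X → ℓ x ≡ Y →
           ∃ λ L → Σ (Walk (adj G) L p x) λ W → count F W ≤ j
    lift here {p} {x} refl ℓx≡ℓp with unfold-component (proj₂ (to (ℓ-comp p x) (sym ℓx≡ℓp)))
    ... | W , count≡0 = _ , W , ℕₚ.≤-reflexive count≡0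
    lift (step {k = j} XY rest) {p} refl ℓx≡Z with to (ℓ-adj _ _) XY
    ... | _ , x′ , y′ , ℓx′≡ℓp , ℓy′≡Y , x′y′
      with unfold-component (proj₂ (to (ℓ-comp p x′) (sym ℓx′≡ℓp))) | lift rest ℓy′≡Y ℓx≡Z
    ...   | W₁ , count₁≡0 | _ , W₂ , count₂≤j = _ , W₁ ++ʷ step x′y′ W₂ , (begin
      count F (W₁ ++ʷ step x′y′ W₂)        ≡⟨ count-++ F W₁ (step x′y′ W₂) ⟩
      count F W₁ + (𝟙 (F x′ y′) + count F W₂) ≡⟨ cong (_+ _) count₁≡0 ⟩
      𝟙 (F x′ y′) + count F W₂             ≤⟨ ℕₚ.+-mono-≤ (𝟙≤1 (F x′ y′)) count₂≤j ⟩
      suc j                                ∎)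
      where open ℕₚ.≤-Reasoning

    connectedH : Connected H
    connectedH X Y with ℓ-surj X | ℓ-surj Y
    ... | p , refl | x , refl = _ , proj₂ (proj₂ (project (proj₂ (connected p x))))

    module H-Metric = Metric H connectedH
    dH : Fin m → Fin m → ℕ
    dH = H-Metric.d

    dH-count : ∀ p x → dH (ℓ p) (ℓ x) ≡ count F (geodesic p x)
    dH-count p x = ℕₚ.≤-antisym ≤count count≤
      where
        ≤count : dH (ℓ p) (ℓ x) ≤ count F (geodesic p x)
        ≤count with project (geodesic p x)
        ... | _ , j≤ , w = ℕₚ.≤-trans (H-Metric.dist-≤-length w) j≤
        count≤ : count F (geodesic p x) ≤ dH (ℓ p) (ℓ x)
        count≤ with lift (H-Metric.geodesic (ℓ p) (ℓ x)) refl refl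
        ... | _ , W , countW≤ = ℕₚ.≤-trans (geodesic-minimises-count F (inBlock-Θ-closed i) p x W) countW≤

    K : Fin n → Fin n → ℕ
    K p x = count Fᶜ (geodesic p x)

    dist-decomposition : ∀ p x → d p x ≡ dH (ℓ p) (ℓ x) + K p x
    dist-decomposition p x = trans (sym (count-complement F (geodesic p x))) (cong (_+ K p x) (sym (dH-count p x)))

    K-≤-across : ∀ {u v} x → adj G u v ≡ true → F u v ≡ true → K u x ≤ K v x
    K-≤-across {u} {v} x uv Fuv =
      ℕₚ.≤-trans (geodesic-minimises-count Fᶜ (outBlock-Θ-closed i) u x (step uv (geodesic v x)))
                 (ℕₚ.≤-reflexive (cong (λ t → 𝟙 (not t) + K v x) Fuv))

    K-across : ∀ {u v} x → adj G u v ≡ true → F u v ≡ true → K u x ≡ K v x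
    K-across {u} {v} x uv Fuv =
      ℕₚ.≤-antisym (K-≤-across x uv Fuv) (K-≤-across x (trans (adj-sym G v u) uv) (trans (F-sym v u) Fuv))

    K-≤-along : ∀ p {x y} → adj G y x ≡ true → F y x ≡ true → K p x ≤ K p y
    K-≤-along p {x} {y} yx Fyx =
      ℕₚ.≤-trans (geodesic-minimises-count Fᶜ (outBlock-Θ-closed i) p x (geodesic p y ++ʷ step yx here))
                 (ℕₚ.≤-reflexive (trans (count-++ Fᶜ (geodesic p y) (step yx here))
                                        (trans (cong (λ t → K p y + (𝟙 (not t) + 0)) Fyx) (ℕₚ.+-identityʳ (K p y)))))

    K-along : ∀ p {x y} → adj G x y ≡ true → F x y ≡ true → K p x ≡ K p y
    K-along p {x} {y} xy Fxy =
      ℕₚ.≤-antisym (K-≤-along p (trans (adj-sym G y x) xy) (trans (F-sym y x) Fxy)) (K-≤-along p xy Fxy)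

    -- An edge of F joining two vertices of one component would be a shortest path with one
    -- F-edge, beaten by the F-free path inside the component.
    ℓ-inside-block : ∀ {x y} → adj G x y ≡ true → F x y ≡ true → ℓ x ≢ ℓ y
    ℓ-inside-block {x} {y} xy Fxy ℓx≡ℓy = ℕₚ.<-irrefl refl (ℕₚ.≤-trans one≤count count≤0)
      where
        component-walk = unfold-component (proj₂ (to (ℓ-comp x y) ℓx≡ℓy))
        count≤0 : count F (geodesic x y) ≤ 0
        count≤0 = ℕₚ.≤-trans (geodesic-minimises-count F (inBlock-Θ-closed i) x y (proj₁ component-walk))
                             (ℕₚ.≤-reflexive (proj₂ component-walk))
        one≤count : 1 ≤ count F (geodesic x y)
        one≤count = ℕₚ.≤-reflexive (sym (trans (count-single-step F (geodesic x y) (dist-≤-length (step xy here))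
                                                                  (adj-irreflexive G xy))
                                               (cong 𝟙 Fxy)))

    adjH-inside-block : ∀ {x y} → adj G x y ≡ true → F x y ≡ true → adj H (ℓ x) (ℓ y) ≡ true
    adjH-inside-block xy Fxy = from (ℓ-adj _ _) (ℓ-inside-block xy Fxy , _ , _ , refl , refl , xy)

    module Equidistance {u v} (uv : adj G u v ≡ true) (Fuv : F u v ≡ true) where
      open ≡-Reasoning

      dist-from-u : ∀ x → d u x ≡ dH (ℓ u) (ℓ x) + K u x
      dist-from-u = dist-decomposition u

      dist-from-v : ∀ x → d v x ≡ dH (ℓ v) (ℓ x) + K u x
      dist-from-v x = trans (dist-decomposition v x) (cong (dH (ℓ v) (ℓ x) +_) (sym (K-across x uv Fuv)))

      equidistant-vertex : ∀ x → (d u x ≡ᵇ d v x) ≡ (dH (ℓ u) (ℓ x) ≡ᵇ dH (ℓ v) (ℓ x))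
      equidistant-vertex x = trans (cong₂ _≡ᵇ_ (dist-from-u x) (dist-from-v x))
                                   (≡ᵇ-cancelʳ (dH (ℓ u) (ℓ x)) (dH (ℓ v) (ℓ x)) (K u x))

      equidistant-outside-block : ∀ {x y} → adj G x y ≡ true → F x y ≡ false →
        (distE (adj G) u x y ≡ᵇ distE (adj G) v x y) ≡ (dH (ℓ u) (ℓ x) ≡ᵇ dH (ℓ v) (ℓ x))
      equidistant-outside-block {x} {y} xy Fxy =
        trans (cong₂ _≡ᵇ_ (split (ℓ u) (dist-from-u x) (dist-from-u y)) (split (ℓ v) (dist-from-v x) (dist-from-v y)))
              (≡ᵇ-cancelʳ (dH (ℓ u) (ℓ x)) (dH (ℓ v) (ℓ x)) (K u x ⊓ K u y))
        where
          split : ∀ W {a b} → a ≡ dH W (ℓ x) + K u x → b ≡ dH W (ℓ y) + K u y →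
                  a ⊓ b ≡ dH W (ℓ x) + (K u x ⊓ K u y)
          split W refl refl = begin
            (dH W (ℓ x) + K u x) ⊓ (dH W (ℓ y) + K u y)
              ≡⟨ cong (λ Y → (dH W (ℓ x) + K u x) ⊓ (dH W Y + K u y)) (sym (ℓ-outside-block xy Fxy)) ⟩
            (dH W (ℓ x) + K u x) ⊓ (dH W (ℓ x) + K u y)
              ≡⟨ ℕₚ.+-distribˡ-⊓ (dH W (ℓ x)) (K u x) (K u y) ⟨
            dH W (ℓ x) + (K u x ⊓ K u y) ∎

      equidistant-inside-block : ∀ {x y} → adj G x y ≡ true → F x y ≡ true →
        (distE (adj G) u x y ≡ᵇ distE (adj G) v x y) ≡ (distE (adj H) (ℓ u) (ℓ x) (ℓ y) ≡ᵇ distE (adj H) (ℓ v) (ℓ x) (ℓ y))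
      equidistant-inside-block {x} {y} xy Fxy =
        trans (cong₂ _≡ᵇ_ (split (ℓ u) (dist-from-u x) (dist-from-u y)) (split (ℓ v) (dist-from-v x) (dist-from-v y)))
              (≡ᵇ-cancelʳ (distE (adj H) (ℓ u) (ℓ x) (ℓ y)) (distE (adj H) (ℓ v) (ℓ x) (ℓ y)) (K u x))
        where
          split : ∀ W {a b} → a ≡ dH W (ℓ x) + K u x → b ≡ dH W (ℓ y) + K u y →
                  a ⊓ b ≡ distE (adj H) W (ℓ x) (ℓ y) + K u x
          split W refl refl = begin
            (dH W (ℓ x) + K u x) ⊓ (dH W (ℓ y) + K u y)
              ≡⟨ cong (λ κ → (dH W (ℓ x) + K u x) ⊓ (dH W (ℓ y) + κ)) (sym (K-along u xy Fxy)) ⟩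
            (dH W (ℓ x) + K u x) ⊓ (dH W (ℓ y) + K u x)
              ≡⟨ ℕₚ.+-distribʳ-⊓ (K u x) (dH W (ℓ x)) (dH W (ℓ y)) ⟨
            distE (adj H) W (ℓ x) (ℓ y) + K u x ∎

open QuotientDistances

UnorderedPair : ∀ {m} → Fin m → Fin m → Fin m → Fin m → Bool
UnorderedPair a b X Y = (⌊ a ≟ X ⌋ ∧ ⌊ b ≟ Y ⌋) ∨ (⌊ a ≟ Y ⌋ ∧ ⌊ b ≟ X ⌋)

module MonoidSums {c ℓ′} (M : CommutativeMonoid c ℓ′) where
  open CommutativeMonoid M renaming (Carrier to W; refl to ≈-refl; sym to ≈-sym; trans to ≈-trans)
  open Weighted M
  open CommSemigroupProperties commutativeSemigroup using (interchange)
  open import Relation.Binary.Reasoning.Setoid setoid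

  when : Bool → W → W
  when b s = if b then s else ε

  ΣV-cong : ∀ {n} {f g : Fin n → W} → (∀ x → f x ≈ g x) → ΣV f ≈ ΣV g
  ΣV-cong {zero}  f≈g = ≈-refl
  ΣV-cong {suc n} f≈g = ∙-cong (f≈g F.zero) (ΣV-cong (λ x → f≈g (F.suc x)))

  ΣV-ε : ∀ {n} → ΣV {n} (λ _ → ε) ≈ ε
  ΣV-ε {zero}  = ≈-refl
  ΣV-ε {suc n} = ≈-trans (identityˡ _) (ΣV-ε {n})

  ΣV-∙ : ∀ {n} (f g : Fin n → W) → ΣV (λ x → f x ∙ g x) ≈ ΣV f ∙ ΣV g
  ΣV-∙ {zero}  f g = ≈-sym (identityˡ ε)
  ΣV-∙ {suc n} f g = ≈-trans (∙-cong ≈-refl (ΣV-∙ (λ x → f (F.suc x)) (λ x → g (F.suc x)))) (interchange _ _ _ _)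

  ΣV-comm : ∀ {n m} (f : Fin n → Fin m → W) → ΣV (λ x → ΣV (f x)) ≈ ΣV (λ y → ΣV (λ x → f x y))
  ΣV-comm {zero}  {m} f = ≈-sym (ΣV-ε {m})
  ΣV-comm {suc n}     f = ≈-trans (∙-cong ≈-refl (ΣV-comm (λ x → f (F.suc x))))
                                (≈-sym (ΣV-∙ (f F.zero) (λ y → ΣV (λ x → f (F.suc x) y))))

  when-cong : ∀ b {s t} → (b ≡ true → s ≈ t) → when b s ≈ when b t
  when-cong true  s≈t = s≈t refl
  when-cong false _   = ≈-refl

  when-ΣV : ∀ {n} b (f : Fin n → W) → when b (ΣV f) ≈ ΣV (λ x → when b (f x))
  when-ΣV     true  f = ≈-refl
  when-ΣV {n} false f = ≈-sym (ΣV-ε {n})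

  when-∙ : ∀ b s t → when b (s ∙ t) ≈ when b s ∙ when b t
  when-∙ true  s t = ≈-refl
  when-∙ false s t = ≈-sym (identityˡ ε)

  ΣV-point : ∀ {m} (a : Fin m) (g : Fin m → W) → ΣV (λ X → when ⌊ a ≟ X ⌋ (g X)) ≈ g a
  ΣV-point {suc m} F.zero    g = ≈-trans (∙-cong ≈-refl (ΣV-ε {m})) (identityʳ _)
  ΣV-point {suc m} (F.suc a) g =
    ≈-trans (identityˡ _) (≈-trans (ΣV-cong (λ X → reflexive (cong (λ b → when b (g (F.suc X))) (≟-suc a X))))
                                   (ΣV-point a (λ X → g (F.suc X))))
    where
      ≟-suc : ∀ {k} (a b : Fin k) → ⌊ F.suc a ≟ F.suc b ⌋ ≡ ⌊ a ≟ b ⌋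
      ≟-suc a b with a ≟ b
      ... | yes _ = refl
      ... | no  _ = refl

  when-ε : ∀ b → when b ε ≈ ε
  when-ε b = reflexive (if-eta b)

  when-∨ : ∀ p q s → p ∧ q ≡ false → when (p ∨ q) s ≈ when p s ∙ when q s
  when-∨ true  false s _ = ≈-sym (identityʳ s)
  when-∨ false true  s _ = ≈-sym (identityˡ s)
  when-∨ false false s _ = ≈-sym (identityˡ ε)

  ΣV-fibres : ∀ {n m} (ℓ : Fin n → Fin m) (h : Fin m → Bool) (f : Fin n → W) →
              ΣV (λ x → when (h (ℓ x)) (f x)) ≈ ΣV (λ X → when (h X) (ΣV (λ x → when ⌊ ℓ x ≟ X ⌋ (f x))))
  ΣV-fibres ℓ h f = ≈-sym (begin
    ΣV (λ X → when (h X) (ΣV (λ x → when ⌊ ℓ x ≟ X ⌋ (f x))))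
      ≈⟨ ΣV-cong (λ X → when-ΣV (h X) (λ x → when ⌊ ℓ x ≟ X ⌋ (f x))) ⟩
    ΣV (λ X → ΣV (λ x → when (h X) (when ⌊ ℓ x ≟ X ⌋ (f x))))
      ≈⟨ ΣV-comm (λ X x → when (h X) (when ⌊ ℓ x ≟ X ⌋ (f x))) ⟩
    ΣV (λ x → ΣV (λ X → when (h X) (when ⌊ ℓ x ≟ X ⌋ (f x))))
      ≈⟨ ΣV-cong (λ x → ΣV-cong (λ X → reflexive (if-swap-then (h X) ⌊ ℓ x ≟ X ⌋))) ⟩
    ΣV (λ x → ΣV (λ X → when ⌊ ℓ x ≟ X ⌋ (when (h X) (f x))))
      ≈⟨ ΣV-cong (λ x → ΣV-point (ℓ x) (λ X → when (h X) (f x))) ⟩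
    ΣV (λ x → when (h (ℓ x)) (f x)) ∎)

  ΣV²-point : ∀ {m} (a b : Fin m) (t : Fin m → Fin m → W) →
              ΣV (λ X → ΣV (λ Y → when (⌊ a ≟ X ⌋ ∧ ⌊ b ≟ Y ⌋) (t X Y))) ≈ t a b
  ΣV²-point a b t = begin
    ΣV (λ X → ΣV (λ Y → when (⌊ a ≟ X ⌋ ∧ ⌊ b ≟ Y ⌋) (t X Y)))
      ≈⟨ ΣV-cong (λ X → ≈-trans (ΣV-cong (λ Y → reflexive (if-∧ ⌊ a ≟ X ⌋ {⌊ b ≟ Y ⌋} {t X Y} {ε})))
                                (≈-sym (when-ΣV ⌊ a ≟ X ⌋ (λ Y → when ⌊ b ≟ Y ⌋ (t X Y))))) ⟩
    ΣV (λ X → when ⌊ a ≟ X ⌋ (ΣV (λ Y → when ⌊ b ≟ Y ⌋ (t X Y))))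
      ≈⟨ ΣV-cong (λ X → when-cong ⌊ a ≟ X ⌋ (λ _ → ΣV-point b (t X))) ⟩
    ΣV (λ X → when ⌊ a ≟ X ⌋ (t X b))  ≈⟨ ΣV-point a (λ X → t X b) ⟩
    t a b                             ∎

  module _ {m : ℕ} (H : SimpleGraph m) where

    isEdge-distinct : ∀ {X Y} → isEdge (adj H) X Y ≡ true → X ≢ Y
    isEdge-distinct {X} e refl with () ← trans (sym e) (cong (_∧ adj H X X) (<ᵇ-false (ℕₚ.≤-refl {toℕ X})))

    UnorderedPair-split : ∀ (a b X Y : Fin m) s →
      when (isEdge (adj H) X Y) (when (UnorderedPair a b X Y) s) ≈
      when (⌊ a ≟ X ⌋ ∧ ⌊ b ≟ Y ⌋) (when (isEdge (adj H) X Y) s) ∙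
      when (⌊ a ≟ Y ⌋ ∧ ⌊ b ≟ X ⌋) (when (isEdge (adj H) X Y) s)
    UnorderedPair-split a b X Y s with isEdge (adj H) X Y in e
    ... | true  = when-∨ _ _ s (disjoint (isEdge-distinct e))
      where
        disjoint : X ≢ Y → (⌊ a ≟ X ⌋ ∧ ⌊ b ≟ Y ⌋) ∧ (⌊ a ≟ Y ⌋ ∧ ⌊ b ≟ X ⌋) ≡ false
        disjoint X≢Y with a ≟ X | a ≟ Y
        ... | yes refl | yes refl = ⊥-elim (X≢Y refl)
        ... | no  _    | _        = refl
        ... | yes _    | no  _    = ∧-zeroʳ _
    ... | false = ≈-sym (≈-trans (∙-cong (when-ε _) (when-ε _)) (identityˡ ε))

    both-orientations : ∀ (g : Fin m → Fin m → W) → (∀ X Y → g X Y ≈ g Y X) → ∀ a b →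
      when (isEdge (adj H) a b) (g a b) ∙ when (isEdge (adj H) b a) (g b a) ≈ when (adj H a b) (g a b)
    both-orientations g g-sym a b with ℕₚ.<-cmp (toℕ a) (toℕ b)
    ... | tri< a<b _ _ rewrite <ᵇ-true a<b | <ᵇ-false (ℕₚ.<⇒≤ a<b) = identityʳ _
    ... | tri≈ _ a≡b _ rewrite Finₚ.toℕ-injective a≡b | <ᵇ-false (ℕₚ.≤-refl {toℕ b}) | adj-irr H b = identityˡ ε
    ... | tri> _ _ b<a rewrite <ᵇ-true b<a | <ᵇ-false (ℕₚ.<⇒≤ b<a) | adj-sym H a b =
      ≈-trans (identityˡ _) (when-cong (adj H b a) (λ _ → g-sym b a))

    ΣE-UnorderedPair : ∀ (g : Fin m → Fin m → W) → (∀ X Y → g X Y ≈ g Y X) → ∀ a b →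
      ΣV (λ X → ΣV (λ Y → when (isEdge (adj H) X Y) (when (UnorderedPair a b X Y) (g X Y)))) ≈ when (adj H a b) (g a b)
    ΣE-UnorderedPair g g-sym a b = begin
      ΣV (λ X → ΣV (λ Y → when (isEdge (adj H) X Y) (when (UnorderedPair a b X Y) (g X Y))))
        ≈⟨ ΣV-cong (λ X → ≈-trans (ΣV-cong (λ Y → UnorderedPair-split a b X Y (g X Y))) (ΣV-∙ (direct X) (reversed X))) ⟩
      ΣV (λ X → ΣV (direct X) ∙ ΣV (reversed X))
        ≈⟨ ΣV-∙ (λ X → ΣV (direct X)) (λ X → ΣV (reversed X)) ⟩
      ΣV (λ X → ΣV (direct X)) ∙ ΣV (λ X → ΣV (reversed X))
        ≈⟨ ∙-cong (ΣV²-point a b e) (≈-trans (ΣV-comm reversed) (ΣV²-point a b (λ Y X → e X Y))) ⟩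
      e a b ∙ e b a
        ≈⟨ both-orientations g g-sym a b ⟩
      when (adj H a b) (g a b) ∎
      where
        e : Fin m → Fin m → W
        e X Y = when (isEdge (adj H) X Y) (g X Y)
        direct reversed : Fin m → Fin m → W
        direct   X Y = when (⌊ a ≟ X ⌋ ∧ ⌊ b ≟ Y ⌋) (e X Y)
        reversed X Y = when (⌊ a ≟ Y ⌋ ∧ ⌊ b ≟ X ⌋) (e X Y)

  ΣV⁴-comm : ∀ {m n} (f : Fin m → Fin m → Fin n → Fin n → W) →
             ΣV (λ X → ΣV (λ Y → ΣV (λ x → ΣV (f X Y x)))) ≈ ΣV (λ x → ΣV (λ y → ΣV (λ X → ΣV (λ Y → f X Y x y))))
  ΣV⁴-comm f = begin
    ΣV (λ X → ΣV (λ Y → ΣV (λ x → ΣV (f X Y x))))          ≈⟨ ΣV-cong (λ X → ΣV-comm (λ Y x → ΣV (f X Y x))) ⟩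
    ΣV (λ X → ΣV (λ x → ΣV (λ Y → ΣV (f X Y x))))          ≈⟨ ΣV-comm (λ X x → ΣV (λ Y → ΣV (f X Y x))) ⟩
    ΣV (λ x → ΣV (λ X → ΣV (λ Y → ΣV (f X Y x))))
      ≈⟨ ΣV-cong (λ x → ≈-trans (ΣV-cong (λ X → ΣV-comm (λ Y → f X Y x))) (ΣV-comm (λ X y → ΣV (λ Y → f X Y x y)))) ⟩
    ΣV (λ x → ΣV (λ y → ΣV (λ X → ΣV (λ Y → f X Y x y)))) ∎

  when-ΣV² : ∀ {n m} β (f : Fin n → Fin m → W) → when β (ΣV (λ x → ΣV (f x))) ≈ ΣV (λ x → ΣV (λ y → when β (f x y)))
  when-ΣV² β f = ≈-trans (when-ΣV β (λ x → ΣV (f x))) (ΣV-cong (λ x → when-ΣV β (f x)))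

  when-rotate : ∀ p q r t s → when p (when q (when r (when t s))) ≡ when r (when p (when t (when q s)))
  when-rotate p q r t s = trans (cong (when p) (if-swap-then q r))
                                (trans (if-swap-then p r) (cong (λ z → when r (when p z)) (if-swap-then q t)))

module QuotientSums {a b} (M : CommutativeMonoid a b) {n m k : ℕ} (G : SimpleGraph n) (connected : Connected G)
                    (c : Fin n → Fin n → Fin k) (c-partition : IsCPartition G c) (i : Fin k)
                    (H : SimpleGraph m) (ℓ : Fin n → Fin m) (quotient : IsQuotient G (inBlock c i) H ℓ)
                    {u v : Fin n} (uv : adj G u v ≡ true) (Fuv : inBlock c i u v ≡ true) where
  open CommutativeMonoid M renaming (Carrier to W; refl to ≈-refl; sym to ≈-sym; trans to ≈-trans)
  open CommSemigroupProperties commutativeSemigroup using (x∙yz≈yx∙z)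
  open Weighted M
  open MonoidSums M
  open QuotientMetric G connected c c-partition i H ℓ quotient
  open Metric G connected using (d)
  open Equidistance uv Fuv
  open import Relation.Binary.Reasoning.Setoid setoid

  equidistantH : Fin m → Bool
  equidistantH X = dH (ℓ u) X ≡ᵇ dH (ℓ v) X

  equidistantᴱH : Fin m → Fin m → Bool
  equidistantᴱH X Y = distE (adj H) (ℓ u) X Y ≡ᵇ distE (adj H) (ℓ v) X Y

  G∖F : Adj n
  G∖F = deleteE (adj G) F

  n₀-quotient : ∀ wv → n₀ (adj G) wv u v ≈ n₀ (adj H) (qwv G F ℓ wv) (ℓ u) (ℓ v)
  n₀-quotient wv = ≈-trans (ΣV-cong (λ x → reflexive (cong (λ β → when β (wv x)) (equidistant-vertex x))))
                           (ΣV-fibres ℓ equidistantH wv)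

  equidistantᴱH-sym : ∀ X Y → equidistantᴱH X Y ≡ equidistantᴱH Y X
  equidistantᴱH-sym X Y = cong₂ _≡ᵇ_ (ℕₚ.⊓-comm (dH (ℓ u) X) (dH (ℓ u) Y)) (ℕₚ.⊓-comm (dH (ℓ v) X) (dH (ℓ v) Y))

  edge-split : ∀ x y (s : W) →
    when (isEdge (adj G) x y) (when (distE (adj G) u x y ≡ᵇ distE (adj G) v x y) s) ≈
    when (isEdge G∖F x y) (when (equidistantH (ℓ x)) s) ∙
    when (isEdge (adj G) x y) (when (adj H (ℓ x) (ℓ y)) (when (equidistantᴱH (ℓ x) (ℓ y)) s))
  edge-split x y s rewrite isEdge-deleteE x y with isEdge (adj G) x y in e | F x y in Fxy
  ... | false | _     = ≈-sym (identityˡ ε)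
  ... | true  | false = begin
    when (distE (adj G) u x y ≡ᵇ distE (adj G) v x y) s
      ≈⟨ reflexive (cong (λ β → when β s) (equidistant-outside-block xy Fxy)) ⟩
    when (equidistantH (ℓ x)) s                                                       ≈⟨ identityʳ _ ⟨
    when (equidistantH (ℓ x)) s ∙ ε
      ≈⟨ ∙-cong ≈-refl (reflexive (cong (λ β → when β (when (equidistantᴱH (ℓ x) (ℓ y)) s)) (sym no-H-edge))) ⟩
    when (equidistantH (ℓ x)) s ∙ when (adj H (ℓ x) (ℓ y)) (when (equidistantᴱH (ℓ x) (ℓ y)) s) ∎
    where
      xy = proj₂ (∧-elim {toℕ x ℕ.<ᵇ toℕ y} e)
      no-H-edge : adj H (ℓ x) (ℓ y) ≡ false
      no-H-edge = trans (cong (adj H (ℓ x)) (sym (ℓ-outside-block xy Fxy))) (adj-irr H (ℓ x))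
  ... | true  | true  = begin
    when (distE (adj G) u x y ≡ᵇ distE (adj G) v x y) s
      ≈⟨ reflexive (cong (λ β → when β s) (equidistant-inside-block xy Fxy)) ⟩
    when (equidistantᴱH (ℓ x) (ℓ y)) s
      ≈⟨ reflexive (cong (λ β → when β (when (equidistantᴱH (ℓ x) (ℓ y)) s)) (sym (adjH-inside-block xy Fxy))) ⟩
    when (adj H (ℓ x) (ℓ y)) (when (equidistantᴱH (ℓ x) (ℓ y)) s)      ≈⟨ identityˡ _ ⟨
    ε ∙ when (adj H (ℓ x) (ℓ y)) (when (equidistantᴱH (ℓ x) (ℓ y)) s) ∎
    where
      xy = proj₂ (∧-elim {toℕ x ℕ.<ᵇ toℕ y} e)

  component-sum : Fin m → (Fin n → Fin n → W) → W
  component-sum X se = ΣE G∖F (λ x y → when (same G F ℓ x X ∧ same G F ℓ y X) (se x y))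

  outside-sum : ∀ (se : Fin n → Fin n → W) →
    ΣV (λ x → ΣV (λ y → when (isEdge G∖F x y) (when (equidistantH (ℓ x)) (se x y)))) ≈
    ΣV (λ X → when (equidistantH X) (component-sum X se))
  outside-sum se = begin
    ΣV (λ x → ΣV (λ y → when (isEdge G∖F x y) (when (equidistantH (ℓ x)) (se x y))))
      ≈⟨ ΣV-cong (λ x → ≈-trans (ΣV-cong (λ y → reflexive (if-swap-then (isEdge G∖F x y) (equidistantH (ℓ x)))))
                               (≈-sym (when-ΣV (equidistantH (ℓ x)) (λ y → when (isEdge G∖F x y) (se x y))))) ⟩
    ΣV (λ x → when (equidistantH (ℓ x)) (ΣV (λ y → when (isEdge G∖F x y) (se x y))))
      ≈⟨ ΣV-fibres ℓ equidistantH (λ x → ΣV (λ y → when (isEdge G∖F x y) (se x y))) ⟩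
    ΣV (λ X → when (equidistantH X) (ΣV (λ x → when (same G F ℓ x X) (ΣV (λ y → when (isEdge G∖F x y) (se x y))))))
      ≈⟨ ΣV-cong (λ X → when-cong (equidistantH X) (λ _ → ΣV-cong (λ x →
           ≈-trans (when-ΣV (same G F ℓ x X) (λ y → when (isEdge G∖F x y) (se x y))) (ΣV-cong (λ y → within-component x y X))))) ⟩
    ΣV (λ X → when (equidistantH X) (component-sum X se)) ∎
    where
      within-component : ∀ x y X → when (same G F ℓ x X) (when (isEdge G∖F x y) (se x y)) ≈
                                   when (isEdge G∖F x y) (when (same G F ℓ x X ∧ same G F ℓ y X) (se x y))
      within-component x y X = ≈-trans (reflexive (if-swap-then (same G F ℓ x X) (isEdge G∖F x y)))
                                     (when-cong (isEdge G∖F x y) (λ e → reflexive (cong (λ β → when β (se x y)) (same-end e))))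
        where
          same-end : isEdge G∖F x y ≡ true → same G F ℓ x X ≡ (same G F ℓ x X ∧ same G F ℓ y X)
          same-end e with deleteE-elim (proj₂ (∧-elim {toℕ x ℕ.<ᵇ toℕ y} e))
          ... | xy , Fxy = sym (trans (cong (λ Y → same G F ℓ x X ∧ ⌊ Y ≟ X ⌋) (sym (ℓ-outside-block xy Fxy)))
                                          (∧-idem (same G F ℓ x X)))

  inside-sum : ∀ (se : Fin n → Fin n → W) →
    ΣV (λ x → ΣV (λ y → when (isEdge (adj G) x y) (when (adj H (ℓ x) (ℓ y)) (when (equidistantᴱH (ℓ x) (ℓ y)) (se x y))))) ≈
    ΣE (adj H) (λ X Y → when (equidistantᴱH X Y) (qe G F ℓ se X Y))
  inside-sum se = ≈-sym (begin
    ΣE (adj H) (λ X Y → when (equidistantᴱH X Y) (qe G F ℓ se X Y))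
      ≈⟨ ΣV-cong (λ X → ΣV-cong (λ Y → ≈-trans (when-cong (isEdge (adj H) X Y) (λ _ → when-ΣV² (equidistantᴱH X Y) (term X Y)))
                                            (when-ΣV² (isEdge (adj H) X Y) (λ x y → when (equidistantᴱH X Y) (term X Y x y))))) ⟩
    ΣV (λ X → ΣV (λ Y → ΣV (λ x → ΣV (λ y → summand X Y x y))))
      ≈⟨ ΣV⁴-comm summand ⟩
    ΣV (λ x → ΣV (λ y → ΣV (λ X → ΣV (λ Y → summand X Y x y))))
      ≈⟨ ΣV-cong (λ x → ΣV-cong (λ y → ≈-trans (ΣV-cong (λ X → ΣV-cong (λ Y → reflexive (rotate X Y x y))))
                                              (≈-sym (when-ΣV² (isEdge (adj G) x y) (pair-term x y))))) ⟩
    ΣV (λ x → ΣV (λ y → when (isEdge (adj G) x y) (ΣV (λ X → ΣV (pair-term x y X)))))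
      ≈⟨ ΣV-cong (λ x → ΣV-cong (λ y → when-cong (isEdge (adj G) x y) (λ _ →
           ΣE-UnorderedPair H (λ X Y → when (equidistantᴱH X Y) (se x y))
                              (λ X Y → reflexive (cong (λ β → when β (se x y)) (equidistantᴱH-sym X Y))) (ℓ x) (ℓ y)))) ⟩
    ΣV (λ x → ΣV (λ y → when (isEdge (adj G) x y) (when (adj H (ℓ x) (ℓ y)) (when (equidistantᴱH (ℓ x) (ℓ y)) (se x y))))) ∎)
    where
      term : Fin m → Fin m → Fin n → Fin n → W
      term X Y x y = when (isEdge (adj G) x y) (when (UnorderedPair (ℓ x) (ℓ y) X Y) (se x y))
      summand : Fin m → Fin m → Fin n → Fin n → W
      summand X Y x y = when (isEdge (adj H) X Y) (when (equidistantᴱH X Y) (term X Y x y))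
      pair-term : Fin n → Fin n → Fin m → Fin m → W
      pair-term x y X Y = when (isEdge (adj H) X Y) (when (UnorderedPair (ℓ x) (ℓ y) X Y) (when (equidistantᴱH X Y) (se x y)))
      rotate : ∀ X Y x y → summand X Y x y ≡ when (isEdge (adj G) x y) (pair-term x y X Y)
      rotate X Y x y = when-rotate (isEdge (adj H) X Y) (equidistantᴱH X Y) (isEdge (adj G) x y)
                                   (UnorderedPair (ℓ x) (ℓ y) X Y) (se x y)

  equidistant-edge-sum : ∀ se →
    ΣE (adj G) (λ x y → when (distE (adj G) u x y ≡ᵇ distE (adj G) v x y) (se x y)) ≈
    ΣV (λ X → when (equidistantH X) (component-sum X se)) ∙ ΣE (adj H) (λ X Y → when (equidistantᴱH X Y) (qe G F ℓ se X Y))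
  equidistant-edge-sum se = begin
    ΣE (adj G) (λ x y → when (distE (adj G) u x y ≡ᵇ distE (adj G) v x y) (se x y))
      ≈⟨ ΣV-cong (λ x → ≈-trans (ΣV-cong (λ y → edge-split x y (se x y))) (ΣV-∙ (outside x) (inside x))) ⟩
    ΣV (λ x → ΣV (outside x) ∙ ΣV (inside x))
      ≈⟨ ΣV-∙ (λ x → ΣV (outside x)) (λ x → ΣV (inside x)) ⟩
    ΣV (λ x → ΣV (outside x)) ∙ ΣV (λ x → ΣV (inside x))
      ≈⟨ ∙-cong (outside-sum se) (inside-sum se) ⟩
    ΣV (λ X → when (equidistantH X) (component-sum X se)) ∙ ΣE (adj H) (λ X Y → when (equidistantᴱH X Y) (qe G F ℓ se X Y)) ∎
    where
      outside inside : Fin n → Fin n → W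
      outside x y = when (isEdge G∖F x y) (when (equidistantH (ℓ x)) (se x y))
      inside  x y = when (isEdge (adj G) x y) (when (adj H (ℓ x) (ℓ y)) (when (equidistantᴱH (ℓ x) (ℓ y)) (se x y)))

  m₀-quotient : ∀ sv se → m₀ (adj G) sv se u v ≈ m₀ (adj H) (qsv G F ℓ sv se) (qe G F ℓ se) (ℓ u) (ℓ v)
  m₀-quotient sv se = begin
    n₀ (adj G) sv u v ∙ ΣE (adj G) (λ x y → when (distE (adj G) u x y ≡ᵇ distE (adj G) v x y) (se x y))
      ≈⟨ ∙-cong (n₀-quotient sv) (equidistant-edge-sum se) ⟩
    ΣV (λ X → when (equidistantH X) (vertices-in X)) ∙ (components ∙ quotient-edges)
      ≈⟨ x∙yz≈yx∙z _ _ _ ⟩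
    (components ∙ ΣV (λ X → when (equidistantH X) (vertices-in X))) ∙ quotient-edges
      ≈⟨ ∙-cong (ΣV-∙ (λ X → when (equidistantH X) (component-sum X se)) (λ X → when (equidistantH X) (vertices-in X))) ≈-refl ⟨
    ΣV (λ X → when (equidistantH X) (component-sum X se) ∙ when (equidistantH X) (vertices-in X)) ∙ quotient-edges
      ≈⟨ ∙-cong (ΣV-cong (λ X → when-∙ (equidistantH X) (component-sum X se) (vertices-in X))) ≈-refl ⟨
    ΣV (λ X → when (equidistantH X) (qsv G F ℓ sv se X)) ∙ quotient-edges ∎
    where
      vertices-in : Fin m → W
      vertices-in X = ΣV (λ x → when (same G F ℓ x X) (sv x))
      components = ΣV (λ X → when (equidistantH X) (component-sum X se))
      quotient-edges = ΣE (adj H) (λ X Y → when (equidistantᴱH X Y) (qe G F ℓ se X Y))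

lemma4p3 : ∀ {a b} (M : CommutativeMonoid a b) →
  ∀ {n m k : ℕ} (G : SimpleGraph n) → Connected G →
  (wv sv : Fin n → CommutativeMonoid.Carrier M) (we se : Fin n → Fin n → CommutativeMonoid.Carrier M) →
  (c : Fin n → Fin n → Fin k) → IsCPartition G c →
  (i : Fin k) (H : SimpleGraph m) (ℓ : Fin n → Fin m) →
  IsQuotient G (inBlock c i) H ℓ →
  (u v : Fin n) → adj G u v ≡ true → at c u v ≡ i →
  (Weighted.n₀ M (adj G) wv u v
    ⟨ CommutativeMonoid._≈_ M ⟩ Weighted.n₀ M (adj H) (Weighted.qwv M G (inBlock c i) ℓ wv) (ℓ u) (ℓ v))
  × (Weighted.m₀ M (adj G) sv se u v
    ⟨ CommutativeMonoid._≈_ M ⟩ Weighted.m₀ M (adj H) (Weighted.qsv M G (inBlock c i) ℓ sv se) (Weighted.qe M G (inBlock c i) ℓ se) (ℓ u) (ℓ v))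
lemma4p3 M G connected wv sv _ se c c-partition i H ℓ quotient u v uv c[uv]≡i =
  n₀-quotient wv , m₀-quotient sv se
  where
    uv∈Eᵢ : inBlock c i u v ≡ true
    uv∈Eᵢ = trans (cong (λ j → ⌊ j ≟ i ⌋) c[uv]≡i) (≟-refl i)
    open QuotientSums M G connected c c-partition i H ℓ quotient uv uv∈Eᵢ
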